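{- Let $\mathcal{I}$ and $\mathcal{J}$ be arcs in $[n]$ and let $\sigma$ be the permutation that reverses the elements of $\mathcal{I}$. Then $\mathcal{I}$ and $\mathcal{J}$ strictly overlap if and only if $\sigma(\mathcal{J})$ is not an arc.
   Context: $[n]=\{0,\dots,n-1\}$ with its standard cyclic order. An arc is a nonempty set of cyclically consecutive elements $\{p,p+1,\dots,p+k\}$ (indices mod $n$). Two arcs $\mathcal{I},\mathcal{J}$ strictly overlap if $\mathcal{I}\not\subset\mathcal{J}$, $\mathcal{J}\not\subset\mathcal{I}$, $\mathcal{I}^c\not\subset\mathcal{J}$ and $\mathcal{J}\not\subset\mathcal{I}^c$ (complements in $[n]$). For an arc $\mathcal{I}=\{a_0,\dots,a_{k-1}\}$ with elements listed in cyclic order starting from one border, the permutation that reverses $\mathcal{I}$ is $\sigma$ with $\sigma(a_j)=a_{k-1-j}$ for $j=0,\dots,k-1$ and $\sigma(x)=x$ for $x\notin\mathcal{I}$. -}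

module Defs where

open import Data.Nat using (ℕ; zero; suc; _+_; _∸_; _≤_; _<_; _<?_; NonZero)
open import Data.Nat.DivMod using (_%_; m%n<n)
open import Data.Fin using (Fin; toℕ; fromℕ<)
open import Data.Product using (Σ; ∃; _×_; _,_)
open import Relation.Binary.PropositionalEquality using (_≡_)
open import Relation.Nullary using (¬_; yes; no)
open import Function.Bundles using (_⇔_)

SubsetP : ℕ → Set₁
SubsetP n = Fin n → Set

_⊆_ : ∀ {n} → SubsetP n → SubsetP n → Set
A ⊆ B = ∀ x → A x → B x

∁ : ∀ {n} → SubsetP n → SubsetP n
∁ A x = ¬ A x

_⊕_ : ∀ {n} .{{_ : NonZero n}} → Fin n → ℕ → Fin n
_⊕_ {n} p i = fromℕ< (m%n<n (toℕ p + i) n)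

arcSet : ∀ {n} .{{_ : NonZero n}} → Fin n → ℕ → SubsetP n
arcSet p ℓ x = Σ ℕ λ i → (i < ℓ) × (x ≡ p ⊕ i)

ValidLen : ℕ → ℕ → Set
ValidLen n ℓ = (1 ≤ ℓ) × (ℓ ≤ n)

IsArc : ∀ {n} .{{_ : NonZero n}} → SubsetP n → Set
IsArc {n} S = Σ (Fin n) λ p → Σ ℕ λ ℓ → ValidLen n ℓ × (∀ x → S x ⇔ arcSet p ℓ x)

StrictlyOverlap : ∀ {n} → SubsetP n → SubsetP n → Set
StrictlyOverlap I J = ¬ (I ⊆ J) × ¬ (J ⊆ I) × ¬ (∁ I ⊆ J) × ¬ (J ⊆ ∁ I)

-- offset of x from p in cyclic order: the unique j < n with x = p ⊕ j
offset : ∀ {n} .{{_ : NonZero n}} → Fin n → Fin n → ℕ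
offset {n} p x = (toℕ x + (n ∸ toℕ p)) % n

reverseArc : ∀ {n} .{{_ : NonZero n}} → Fin n → ℕ → Fin n → Fin n
reverseArc p ℓ x with offset p x <? ℓ
... | yes _ = p ⊕ (ℓ ∸ 1 ∸ offset p x)
... | no  _ = x

image : ∀ {n} → (Fin n → Fin n) → SubsetP n → SubsetP n
image f A y = ∃ λ x → A x × (f x ≡ y)

-- Measure positions by their offset from p: [n] becomes 0, …, n-1, the arc I becomes the
-- initial segment [0, ℓ) and σ reflects it. In these coordinates an arc is a nonempty set
-- that is an interval or the complement of one, so the set itself or its complement is convex.
-- If I and J strictly overlap, points of I ∖ J, of J ∖ I, of neither and of both yield, once
-- those inside I are reflected, four increasing positions alternately in and out of σ(J);
-- neither a convex set nor the complement of one admits such a pattern. Otherwise J contains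
-- I or misses it, and σ(J) = J; or J lies inside I, and σ(J) is J reflected; or J contains
-- the complement of I, which is the previous case applied to the complement of J.
module Submission where

open import Defs
open import Data.Nat using (ℕ; suc; _+_; _∸_; _⊓_; _≤_; _<_; _≤?_; _<?_; s≤s; z≤n; NonZero)
open import Data.Nat.Properties
open import Data.Nat.DivMod using (_%_; %-distribˡ-+; m%n%n≡m%n; [m+n]%n≡m%n; m<n⇒m%n≡m; m%n<n)
open import Data.Fin using (Fin; toℕ; fromℕ<)
open import Data.Fin.Properties using (toℕ-fromℕ<; toℕ-injective; toℕ<n; ¬∀⟶∃¬)
open import Data.Product using (∃; _×_; _,_; proj₁; proj₂)
open import Data.Sum using (_⊎_; inj₁; inj₂; [_,_])
open import Relation.Binary.PropositionalEquality using (_≡_; refl; sym; trans; cong; subst; module ≡-Reasoning)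
open import Relation.Nullary using (¬_; Dec; yes; no; contradiction)
open import Relation.Nullary.Decidable using (decidable-stable; ¬?; _×-dec_; _→-dec_; map)
import Relation.Unary as U
open import Function.Base using (_∘_; id)
open import Function.Bundles using (_⇔_; mk⇔; Equivalence)
open import Function.Properties.Equivalence using () renaming (trans to ⇔-trans; sym to ⇔-sym)
open import Function.Related.TypeIsomorphisms using (¬-cong-⇔)
open import Function.Related.Propositional using (equivalence; module EquationalReasoning)
open import Data.Product.Function.NonDependent.Propositional using (_×-⇔_)

open Equivalence using (to; from)

¬¬⇔ : ∀ {A : Set} → Dec A → (¬ ¬ A) ⇔ A
¬¬⇔ A? = mk⇔ (decidable-stable A?) (λ a ¬a → ¬a a)

image-involution : ∀ {n} {f : Fin n → Fin n} {A : SubsetP n} →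
  (∀ x → f (f x) ≡ x) → ∀ y → image f A y ⇔ A (f y)
image-involution {f = f} {A} f∘f y =
  mk⇔ (λ (x , Ax , fx≡y) → subst A (trans (sym (f∘f x)) (cong f fx≡y)) Ax)
      (λ A[fy] → f y , A[fy] , f∘f y)

Between : ℕ → ℕ → ℕ → Set
Between a b u = a ≤ u × u < b

between? : ∀ a b u → Dec (Between a b u)
between? a b u = a ≤? u ×-dec u <? b

reflect : ℕ → ℕ → ℕ
reflect ℓ u with u <? ℓ
... | yes _ = ℓ ∸ 1 ∸ u
... | no  _ = u

module _ {ℓ : ℕ} where

  reflect-+ : ∀ {u} → u < ℓ → reflect ℓ u + suc u ≡ ℓ
  reflect-+ {u} u<ℓ with u <? ℓ
  ... | yes _   = trans (cong (_+ suc u) (∸-+-assoc ℓ 1 u)) (m∸n+n≡m u<ℓ)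
  ... | no u≮ℓ = contradiction u<ℓ u≮ℓ

  reflect-outside : ∀ {u} → ¬ u < ℓ → reflect ℓ u ≡ u
  reflect-outside {u} u≮ℓ with u <? ℓ
  ... | yes u<ℓ = contradiction u<ℓ u≮ℓ
  ... | no _    = refl

  reflect-<ℓ : ∀ {u} → u < ℓ → reflect ℓ u < ℓ
  reflect-<ℓ {u} u<ℓ = subst (reflect ℓ u <_) (reflect-+ u<ℓ) (m<m+n _ (s≤s z≤n))

  reflect-reverses-< : ∀ {u v} → u < v → v < ℓ → reflect ℓ v < reflect ℓ u
  reflect-reverses-< {u} {v} u<v v<ℓ = +-cancelʳ-< (suc u) _ _ (begin-strict
    reflect ℓ v + suc u <⟨ +-monoʳ-< (reflect ℓ v) (s≤s u<v) ⟩
    reflect ℓ v + suc v ≡⟨ reflect-+ v<ℓ ⟩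
    ℓ                   ≡⟨ reflect-+ (<-trans u<v v<ℓ) ⟨
    reflect ℓ u + suc u ∎)
    where open ≤-Reasoning

  reflect-involutive : ∀ u → reflect ℓ (reflect ℓ u) ≡ u
  reflect-involutive u = by-cases (u <? ℓ)
    where
    open ≡-Reasoning
    r = reflect ℓ u
    by-cases : Dec (u < ℓ) → reflect ℓ r ≡ u
    by-cases (no u≮ℓ) = trans (cong (reflect ℓ) (reflect-outside u≮ℓ)) (reflect-outside u≮ℓ)
    by-cases (yes u<ℓ) = +-cancelʳ-≡ (suc r) _ _ (begin
      reflect ℓ r + suc r ≡⟨ reflect-+ (reflect-<ℓ u<ℓ) ⟩
      ℓ                   ≡⟨ reflect-+ u<ℓ ⟨
      r + suc u           ≡⟨ +-suc r u ⟩
      suc (r + u)         ≡⟨ cong suc (+-comm r u) ⟩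
      suc (u + r)         ≡⟨ +-suc u r ⟨
      u + suc r           ∎)

  ≤-reflect : ∀ {a u} → u < ℓ → a ≤ reflect ℓ u ⇔ u < ℓ ∸ a
  ≤-reflect {a} {u} u<ℓ = mk⇔
    (λ a≤r → m+n≤o⇒m≤o∸n (suc u)
      (subst (_≤ ℓ) (+-comm a (suc u)) (subst (a + suc u ≤_) (reflect-+ u<ℓ) (+-monoˡ-≤ (suc u) a≤r))))
    (λ u<ℓ∸a → +-cancelʳ-≤ (suc u) a _
      (subst (a + suc u ≤_) (sym (reflect-+ u<ℓ))
        (subst (_≤ ℓ) (+-comm (suc u) a) (m≤o∸n⇒m+n≤o (suc u) (a≤ℓ u<ℓ∸a) u<ℓ∸a))))
    where
    a≤ℓ : u < ℓ ∸ a → a ≤ ℓ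
    a≤ℓ u<ℓ∸a = <⇒≤ (m∸n≢0⇒n<m (λ ℓ∸a≡0 → contradiction (subst (u <_) ℓ∸a≡0 u<ℓ∸a) λ ()))

  reflect-Between : ∀ {a b u} → b ≤ ℓ → Between a b (reflect ℓ u) ⇔ Between (ℓ ∸ b) (ℓ ∸ a) u
  reflect-Between {a} {b} {u} b≤ℓ = by-cases (u <? ℓ)
    where
    by-cases : Dec (u < ℓ) → Between a b (reflect ℓ u) ⇔ Between (ℓ ∸ b) (ℓ ∸ a) u
    by-cases (yes u<ℓ) = mk⇔
      (λ (a≤r , r<b) → ≮⇒≥ (λ u<ℓ∸b → <⇒≱ r<b (from (≤-reflect u<ℓ) u<ℓ∸b)) , to (≤-reflect u<ℓ) a≤r)
      (λ (ℓ∸b≤u , u<ℓ∸a) → from (≤-reflect u<ℓ) u<ℓ∸a , ≰⇒> (λ b≤r → <⇒≱ (to (≤-reflect u<ℓ) b≤r) ℓ∸b≤u))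
    by-cases (no u≮ℓ) rewrite reflect-outside u≮ℓ = mk⇔
      (λ (_ , u<b) → contradiction (<-≤-trans u<b b≤ℓ) u≮ℓ)
      (λ (_ , u<ℓ∸a) → contradiction (<-≤-trans u<ℓ∸a (m∸n≤m ℓ a)) u≮ℓ)

module Coordinates (n : ℕ) where

  infix 4 _≐_ _⊆ₙ_ _⊈ₙ_

  _≐_ : (P Q : ℕ → Set) → Set
  P ≐ Q = ∀ {u} → u < n → P u ⇔ Q u

  ≐-refl : ∀ {P} → P ≐ P
  ≐-refl _ = mk⇔ id id

  ≐-sym : ∀ {P Q} → P ≐ Q → Q ≐ P
  ≐-sym P≐Q u<n = ⇔-sym (P≐Q u<n)

  ≐-trans : ∀ {P Q R} → P ≐ Q → Q ≐ R → P ≐ R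
  ≐-trans P≐Q Q≐R u<n = ⇔-trans (P≐Q u<n) (Q≐R u<n)

  ≐-∁ : ∀ {P Q} → P ≐ Q → U.∁ P ≐ U.∁ Q
  ≐-∁ P≐Q u<n = ¬-cong-⇔ (P≐Q u<n)

  Decidableₙ : (ℕ → Set) → Set
  Decidableₙ P = ∀ {u} → u < n → Dec (P u)

  _⊆ₙ_ : (A B : ℕ → Set) → Set
  A ⊆ₙ B = ∀ {u} → u < n → A u → B u

  _⊈ₙ_ : (A B : ℕ → Set) → Set
  A ⊈ₙ B = ∃ λ u → u < n × A u × ¬ B u

  StrictlyOverlapₙ : (A B : ℕ → Set) → Set
  StrictlyOverlapₙ A B = ¬ (A ⊆ₙ B) × ¬ (B ⊆ₙ A) × ¬ (U.∁ A ⊆ₙ B) × ¬ (B ⊆ₙ U.∁ A)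

  Crossing : (A B : ℕ → Set) → Set
  Crossing A B = A ⊈ₙ B × B ⊈ₙ A × U.∁ A ⊈ₙ B × B ⊈ₙ U.∁ A

  ¬⊆ₙ⇒⊈ₙ : ∀ {A B} → Decidableₙ A → Decidableₙ B → ¬ (A ⊆ₙ B) → A ⊈ₙ B
  ¬⊆ₙ⇒⊈ₙ {A} {B} A? B? ¬A⊆B
    with ¬∀⟶∃¬ n (λ i → A (toℕ i) → B (toℕ i)) (λ i → A? (toℕ<n i) →-dec B? (toℕ<n i)) ¬∀A→B
    where
    ¬∀A→B : ¬ (∀ i → A (toℕ i) → B (toℕ i))
    ¬∀A→B A→B = ¬A⊆B λ u<n Au →
      subst B (toℕ-fromℕ< u<n) (A→B (fromℕ< u<n) (subst A (sym (toℕ-fromℕ< u<n)) Au))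
  ... | i , ¬[A→B] with A? (toℕ<n i)
  ...   | yes Ai = toℕ i , toℕ<n i , Ai , λ Bi → ¬[A→B] λ _ → Bi
  ...   | no ¬Ai = contradiction (λ Ai → contradiction Ai ¬Ai) ¬[A→B]

  crossing : ∀ {A B} → Decidableₙ A → Decidableₙ B → StrictlyOverlapₙ A B → Crossing A B
  crossing {A} A? B? (¬A⊆B , ¬B⊆A , ¬∁A⊆B , ¬B⊆∁A) =
    ¬⊆ₙ⇒⊈ₙ A? B? ¬A⊆B , ¬⊆ₙ⇒⊈ₙ B? A? ¬B⊆A , ¬⊆ₙ⇒⊈ₙ ∁A? B? ¬∁A⊆B , ¬⊆ₙ⇒⊈ₙ B? ∁A? ¬B⊆∁A
    where
    ∁A? : Decidableₙ (U.∁ A)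
    ∁A? u<n = ¬? (A? u<n)

  Crossing-∁ : ∀ {A B} → Decidableₙ A → Crossing A B → Crossing A (U.∁ B)
  Crossing-∁ A? ((u₁ , u₁<n , Au₁ , ¬Bu₁) , (u₂ , u₂<n , Bu₂ , ¬Au₂) ,
                 (u₃ , u₃<n , ¬Au₃ , ¬Bu₃) , (u₄ , u₄<n , Bu₄ , ¬¬Au₄)) =
    (u₄ , u₄<n , decidable-stable (A? u₄<n) ¬¬Au₄ , λ ¬Bu₄ → ¬Bu₄ Bu₄) ,
    (u₃ , u₃<n , ¬Bu₃ , ¬Au₃) ,
    (u₂ , u₂<n , ¬Au₂ , λ ¬Bu₂ → ¬Bu₂ Bu₂) ,
    (u₁ , u₁<n , ¬Bu₁ , λ ¬Au₁ → ¬Au₁ Au₁)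

  Convex : (ℕ → Set) → Set
  Convex P = ∀ {x y z} → x ≤ y → y ≤ z → z < n → P x → P z → P y

  Between-convex : ∀ {a b} → Convex (Between a b)
  Between-convex x≤y y≤z _ (a≤x , _) (_ , z<b) = ≤-trans a≤x x≤y , ≤-<-trans y≤z z<b

  Convex-resp : ∀ {P Q} → P ≐ Q → Convex Q → Convex P
  Convex-resp P≐Q convex x≤y y≤z z<n Px Pz = from (P≐Q y<n)
    (convex x≤y y≤z z<n (to (P≐Q (≤-<-trans x≤y y<n)) Px) (to (P≐Q z<n) Pz))
    where y<n = ≤-<-trans y≤z z<n

  ∁∁-Between : ∀ {a b} → U.∁ (U.∁ (Between a b)) ≐ Between a b
  ∁∁-Between {a} {b} {u} _ = ¬¬⇔ (between? a b u)

  -- Up to nonemptiness, these are the arcs of [n] seen in coordinates.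
  data IntervalOrCo (P : ℕ → Set) : Set where
    interval   : ∀ {a b} → b ≤ n → P ≐ Between a b → IntervalOrCo P
    cointerval : ∀ {a b} → b ≤ n → P ≐ U.∁ (Between a b) → IntervalOrCo P

  IntervalOrCo-resp : ∀ {P Q} → P ≐ Q → IntervalOrCo P → IntervalOrCo Q
  IntervalOrCo-resp P≐Q (interval b≤n P≐I)   = interval b≤n (≐-trans (≐-sym P≐Q) P≐I)
  IntervalOrCo-resp P≐Q (cointerval b≤n P≐C) = cointerval b≤n (≐-trans (≐-sym P≐Q) P≐C)

  IntervalOrCo-dec : ∀ {P} → IntervalOrCo P → Decidableₙ P
  IntervalOrCo-dec (interval {a} {b} _ P≐I) {u} u<n = map (⇔-sym (P≐I u<n)) (between? a b u)
  IntervalOrCo-dec (cointerval {a} {b} _ P≐C) {u} u<n = map (⇔-sym (P≐C u<n)) (¬? (between? a b u))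

  IntervalOrCo-∁ : ∀ {P} → IntervalOrCo P → IntervalOrCo (U.∁ P)
  IntervalOrCo-∁ (interval b≤n P≐I)   = cointerval b≤n (≐-∁ P≐I)
  IntervalOrCo-∁ (cointerval b≤n P≐C) = interval b≤n (≐-trans (≐-∁ P≐C) ∁∁-Between)

  IntervalOrCo-∁⁻¹ : ∀ {P} → Decidableₙ P → IntervalOrCo (U.∁ P) → IntervalOrCo P
  IntervalOrCo-∁⁻¹ P? ∁P = IntervalOrCo-resp (λ u<n → ¬¬⇔ (P? u<n)) (IntervalOrCo-∁ ∁P)

  IntervalOrCo⇒Convex⊎Convex∁ : ∀ {P} → IntervalOrCo P → Convex P ⊎ Convex (U.∁ P)
  IntervalOrCo⇒Convex⊎Convex∁ (interval _ P≐I) = inj₁ (Convex-resp P≐I Between-convex)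
  IntervalOrCo⇒Convex⊎Convex∁ (cointerval _ P≐C) =
    inj₂ (Convex-resp (≐-trans (≐-∁ P≐C) ∁∁-Between) Between-convex)

  record Alternation (Q : ℕ → Set) : Set where
    constructor alternation
    field
      {x y z w} : ℕ
      x<y : x < y
      y<z : y < z
      z<w : z < w
      w<n : w < n
      Qx  : Q x
      ¬Qy : ¬ Q y
      Qz  : Q z
      ¬Qw : ¬ Q w

  Alternation⇒¬Convex : ∀ {Q} → Alternation Q → ¬ Convex Q
  Alternation⇒¬Convex (alternation x<y y<z z<w w<n Qx ¬Qy Qz _) convex =
    ¬Qy (convex (<⇒≤ x<y) (<⇒≤ y<z) (<-trans z<w w<n) Qx Qz)

  Alternation⇒¬Convex∁ : ∀ {Q} → Alternation Q → ¬ Convex (U.∁ Q)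
  Alternation⇒¬Convex∁ (alternation _ y<z z<w w<n _ ¬Qy Qz ¬Qw) convex =
    convex (<⇒≤ y<z) (<⇒≤ z<w) w<n ¬Qy ¬Qw Qz

  IntervalOrCo⇒¬Alternation : ∀ {Q} → IntervalOrCo Q → ¬ Alternation Q
  IntervalOrCo⇒¬Alternation Q-arc alt =
    [ Alternation⇒¬Convex alt , Alternation⇒¬Convex∁ alt ] (IntervalOrCo⇒Convex⊎Convex∁ Q-arc)

  -- s, s + 1, …, s + m - 1 taken mod n: the values below n, and those that wrapped around.
  Run : ℕ → ℕ → ℕ → Set
  Run s m u = Between s (s + m) u ⊎ u + n < s + m

  Run-≐-Between : ∀ {s m} → s + m ≤ n → Run s m ≐ Between s (s + m)
  Run-≐-Between {s} {m} s+m≤n {u} _ = mk⇔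
    [ id , (λ u+n<s+m → contradiction (≤-trans s+m≤n (m≤n+m n u)) (<⇒≱ u+n<s+m)) ] inj₁

  Run-≐-∁Between : ∀ {s m} → n ≤ s + m → Run s m ≐ U.∁ (Between (s + m ∸ n) s)
  Run-≐-∁Between {s} {m} n≤s+m {u} u<n = mk⇔
    [ (λ (s≤u , _) (_ , u<s) → <⇒≱ u<s s≤u) , (λ u+n<s+m (k≤u , _) → <⇒≱ u+n<s+m (k+n≤u+n k≤u)) ]
    inRun
    where
    k+n≤u+n : s + m ∸ n ≤ u → s + m ≤ u + n
    k+n≤u+n k≤u = subst (_≤ u + n) (m∸n+n≡m n≤s+m) (+-monoˡ-≤ n k≤u)
    inRun : ¬ Between (s + m ∸ n) s u → Run s m u
    inRun ¬between with s ≤? u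
    ... | yes s≤u = inj₁ (s≤u , <-≤-trans u<n n≤s+m)
    ... | no s≰u with s + m ∸ n ≤? u
    ...   | yes k≤u = contradiction (k≤u , ≰⇒> s≰u) ¬between
    ...   | no k≰u  = inj₂ (subst (u + n <_) (m∸n+n≡m n≤s+m) (+-monoˡ-< n (≰⇒> k≰u)))

  Run-IntervalOrCo : ∀ {s m} → s ≤ n → IntervalOrCo (Run s m)
  Run-IntervalOrCo {s} {m} s≤n with s + m ≤? n
  ... | yes s+m≤n = interval s+m≤n (Run-≐-Between s+m≤n)
  ... | no s+m≰n  = cointerval s≤n (Run-≐-∁Between (<⇒≤ (≰⇒> s+m≰n)))

  module Reflection (ℓ : ℕ) (ℓ≤n : ℓ ≤ n) where

    reflect-<n : ∀ {u} → u < n → reflect ℓ u < n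
    reflect-<n {u} u<n = by-cases (u <? ℓ)
      where
      by-cases : Dec (u < ℓ) → reflect ℓ u < n
      by-cases (yes u<ℓ) = <-≤-trans (reflect-<ℓ u<ℓ) ℓ≤n
      by-cases (no u≮ℓ)  = subst (_< n) (sym (reflect-outside u≮ℓ)) u<n

    ≐-reflect : ∀ {P Q} → P ≐ Q → P ∘ reflect ℓ ≐ Q ∘ reflect ℓ
    ≐-reflect P≐Q u<n = P≐Q (reflect-<n u<n)

    reflect-≐-constant : ∀ {P} → (∀ {u v} → u < ℓ → v < ℓ → P u → P v) → P ∘ reflect ℓ ≐ P
    reflect-≐-constant {P} constant {u} _ = by-cases (u <? ℓ)
      where
      by-cases : Dec (u < ℓ) → P (reflect ℓ u) ⇔ P u
      by-cases (yes u<ℓ) = mk⇔ (constant (reflect-<ℓ u<ℓ) u<ℓ) (constant u<ℓ (reflect-<ℓ u<ℓ))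
      by-cases (no u≮ℓ) rewrite reflect-outside u≮ℓ = mk⇔ id id

    reflect-≐-⊇ : ∀ {P} → (_< ℓ) ⊆ₙ P → P ∘ reflect ℓ ≐ P
    reflect-≐-⊇ I⊆P = reflect-≐-constant λ _ v<ℓ _ → I⊆P (<-≤-trans v<ℓ ℓ≤n) v<ℓ

    reflect-≐-disjoint : ∀ {P} → P ⊆ₙ U.∁ (_< ℓ) → P ∘ reflect ℓ ≐ P
    reflect-≐-disjoint P⊆∁I = reflect-≐-constant λ u<ℓ _ Pu →
      contradiction u<ℓ (P⊆∁I (<-≤-trans u<ℓ ℓ≤n) Pu)

    reflect-interval : ∀ {P a b} → b ≤ ℓ → P ≐ Between a b → IntervalOrCo (P ∘ reflect ℓ)
    reflect-interval {a = a} b≤ℓ P≐I =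
      interval (≤-trans (m∸n≤m ℓ a) ℓ≤n) (≐-trans (≐-reflect P≐I) (λ _ → reflect-Between b≤ℓ))

    reflect-IntervalOrCo-⊆ : ∀ {P} → P ⊆ₙ (_< ℓ) → IntervalOrCo P → IntervalOrCo (P ∘ reflect ℓ)
    reflect-IntervalOrCo-⊆ {P} P⊆I (interval {a} {b} _ P≐I) =
      reflect-interval (m⊓n≤n b ℓ) λ u<n → mk⇔
        (λ Pu → let a≤u , u<b = to (P≐I u<n) Pu in a≤u , ⊓-pres-m< u<b (P⊆I u<n Pu))
        (λ (a≤u , u<b⊓ℓ) → from (P≐I u<n) (a≤u , <-≤-trans u<b⊓ℓ (m⊓n≤m b ℓ)))
    reflect-IntervalOrCo-⊆ {P} P⊆I (cointerval {a} {b} b≤n P≐C) with ℓ <? n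
    ... | no ℓ≮n = cointerval (≤-trans (m∸n≤m ℓ a) ℓ≤n)
            (≐-trans (≐-reflect P≐C) (λ _ → ¬-cong-⇔ (reflect-Between (≤-trans b≤n (≮⇒≥ ℓ≮n)))))
    ... | yes ℓ<n = reflect-interval a≤ℓ λ u<n → mk⇔
            (λ Pu → z≤n , ≰⇒> (λ a≤u → to (P≐C u<n) Pu (a≤u , <-trans (P⊆I u<n Pu) ℓ<b)))
            (λ (_ , u<a) → from (P≐C u<n) (λ (a≤u , _) → <⇒≱ u<a a≤u))
      where
      -- ℓ lies outside P ⊆ [0, ℓ), hence in [a, b); so [ℓ, n) ⊆ [a, b) and P is just [0, a).
      a≤ℓ<b : Between a b ℓ
      a≤ℓ<b = decidable-stable (between? a b ℓ) λ ¬between →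
        <-irrefl refl (P⊆I ℓ<n (from (P≐C ℓ<n) ¬between))
      a≤ℓ = proj₁ a≤ℓ<b
      ℓ<b = proj₂ a≤ℓ<b

    reflect-IntervalOrCo-⊇∁ : ∀ {P} → U.∁ (_< ℓ) ⊆ₙ P → IntervalOrCo P → IntervalOrCo (P ∘ reflect ℓ)
    reflect-IntervalOrCo-⊇∁ {P} ∁I⊆P P-arc = IntervalOrCo-∁⁻¹
      (λ u<n → IntervalOrCo-dec P-arc (reflect-<n u<n))
      (reflect-IntervalOrCo-⊆ ∁P⊆I (IntervalOrCo-∁ P-arc))
      where
      ∁P⊆I : U.∁ P ⊆ₙ (_< ℓ)
      ∁P⊆I {u} u<n ¬Pu = decidable-stable (u <? ℓ) λ u≮ℓ → ¬Pu (∁I⊆P u<n u≮ℓ)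

    crossing⇒Alternation : ∀ {P} → Convex P → Crossing (_< ℓ) P → Alternation (P ∘ reflect ℓ)
    crossing⇒Alternation {P} convex
      ((u₁ , _ , u₁<ℓ , ¬Pu₁) , (u₂ , u₂<n , Pu₂ , u₂≮ℓ) , (u₃ , u₃<n , u₃≮ℓ , ¬Pu₃) , (u₄ , _ , Pu₄ , ¬¬u₄<ℓ)) =
      alternation (reflect-reverses-< u₁<u₄ u₄<ℓ) (<-≤-trans (reflect-<ℓ u₁<ℓ) (≮⇒≥ u₂≮ℓ)) u₂<u₃ u₃<n
        (subst P (sym (reflect-involutive {ℓ} u₄)) Pu₄)
        (¬Pu₁ ∘ subst P (reflect-involutive {ℓ} u₁))
        (subst P (sym (reflect-outside u₂≮ℓ)) Pu₂)
        (¬Pu₃ ∘ subst P (reflect-outside u₃≮ℓ))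
      where
      u₄<ℓ = decidable-stable (u₄ <? ℓ) ¬¬u₄<ℓ
      u₁<u₄ : u₁ < u₄
      u₁<u₄ = ≰⇒> λ u₄≤u₁ → ¬Pu₁ (convex u₄≤u₁ (<⇒≤ (<-≤-trans u₁<ℓ (≮⇒≥ u₂≮ℓ))) u₂<n Pu₄ Pu₂)
      u₂<u₃ : u₂ < u₃
      u₂<u₃ = ≰⇒> λ u₃≤u₂ → ¬Pu₃ (convex (<⇒≤ (<-≤-trans u₄<ℓ (≮⇒≥ u₃≮ℓ))) u₃≤u₂ u₂<n Pu₄ Pu₂)

    reflect-IntervalOrCo-iff : ∀ {P} → IntervalOrCo P →
      StrictlyOverlapₙ (_< ℓ) P ⇔ (¬ IntervalOrCo (P ∘ reflect ℓ))
    reflect-IntervalOrCo-iff {P} P-arc = mk⇔ overlap⇒¬reflected ¬reflected⇒overlap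
      where
      I? : Decidableₙ (_< ℓ)
      I? {u} _ = u <? ℓ
      overlap⇒¬reflected : StrictlyOverlapₙ (_< ℓ) P → ¬ IntervalOrCo (P ∘ reflect ℓ)
      overlap⇒¬reflected strict reflected
        with crossing I? (IntervalOrCo-dec P-arc) strict | IntervalOrCo⇒Convex⊎Convex∁ P-arc
      ... | cross | inj₁ convex =
        IntervalOrCo⇒¬Alternation reflected (crossing⇒Alternation convex cross)
      ... | cross | inj₂ convex∁ =
        IntervalOrCo⇒¬Alternation (IntervalOrCo-∁ reflected) (crossing⇒Alternation convex∁ (Crossing-∁ I? cross))
      ¬reflected⇒overlap : ¬ IntervalOrCo (P ∘ reflect ℓ) → StrictlyOverlapₙ (_< ℓ) P
      ¬reflected⇒overlap ¬reflected =
        (λ I⊆P → ¬reflected (IntervalOrCo-resp (≐-sym (reflect-≐-⊇ I⊆P)) P-arc)) ,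
        (λ P⊆I → ¬reflected (reflect-IntervalOrCo-⊆ P⊆I P-arc)) ,
        (λ ∁I⊆P → ¬reflected (reflect-IntervalOrCo-⊇∁ ∁I⊆P P-arc)) ,
        (λ P⊆∁I → ¬reflected (IntervalOrCo-resp (≐-sym (reflect-≐-disjoint P⊆∁I)) P-arc))

module _ {n : ℕ} .{{_ : NonZero n}} where

  open Coordinates n

  [m%n+k]%n≡[m+k]%n : ∀ a b → (a % n + b) % n ≡ (a + b) % n
  [m%n+k]%n≡[m+k]%n a b = begin
    (a % n + b) % n         ≡⟨ %-distribˡ-+ (a % n) b n ⟩
    (a % n % n + b % n) % n ≡⟨ cong (λ t → (t + b % n) % n) (m%n%n≡m%n a n) ⟩
    (a % n + b % n) % n     ≡⟨ %-distribˡ-+ a b n ⟨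
    (a + b) % n             ∎
    where open ≡-Reasoning

  [m+k%n]%n≡[m+k]%n : ∀ a b → (a + b % n) % n ≡ (a + b) % n
  [m+k%n]%n≡[m+k]%n a b = begin
    (a + b % n) % n ≡⟨ cong (_% n) (+-comm a (b % n)) ⟩
    (b % n + a) % n ≡⟨ [m%n+k]%n≡[m+k]%n b a ⟩
    (b + a) % n     ≡⟨ cong (_% n) (+-comm b a) ⟩
    (a + b) % n     ∎
    where open ≡-Reasoning

  n≤m<n+n⇒m%n+n≡m : ∀ {x} → n ≤ x → x < n + n → x % n + n ≡ x
  n≤m<n+n⇒m%n+n≡m {x} n≤x x<2n = begin
    x % n + n           ≡⟨ cong (λ t → t % n + n) (m∸n+n≡m n≤x) ⟨
    (x ∸ n + n) % n + n ≡⟨ cong (_+ n) ([m+n]%n≡m%n (x ∸ n) n) ⟩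
    (x ∸ n) % n + n     ≡⟨ cong (_+ n) (m<n⇒m%n≡m (m<n+o⇒m∸n<o x n x<2n)) ⟩
    x ∸ n + n           ≡⟨ m∸n+n≡m n≤x ⟩
    x                   ∎
    where open ≡-Reasoning

  toℕ-⊕ : ∀ (p : Fin n) i → toℕ (p ⊕ i) ≡ (toℕ p + i) % n
  toℕ-⊕ p i = toℕ-fromℕ< _

  ⊕-+ : ∀ (p : Fin n) a i → (p ⊕ a) ⊕ i ≡ p ⊕ (a + i)
  ⊕-+ p a i = toℕ-injective (begin
    toℕ ((p ⊕ a) ⊕ i)         ≡⟨ toℕ-⊕ (p ⊕ a) i ⟩
    (toℕ (p ⊕ a) + i) % n     ≡⟨ cong (λ t → (t + i) % n) (toℕ-⊕ p a) ⟩
    ((toℕ p + a) % n + i) % n ≡⟨ [m%n+k]%n≡[m+k]%n (toℕ p + a) i ⟩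
    (toℕ p + a + i) % n       ≡⟨ cong (_% n) (+-assoc (toℕ p) a i) ⟩
    (toℕ p + (a + i)) % n     ≡⟨ toℕ-⊕ p (a + i) ⟨
    toℕ (p ⊕ (a + i))         ∎)
    where open ≡-Reasoning

  ⊕-% : ∀ (p : Fin n) i → p ⊕ (i % n) ≡ p ⊕ i
  ⊕-% p i = toℕ-injective (trans (toℕ-⊕ p (i % n)) (trans ([m+k%n]%n≡[m+k]%n (toℕ p) i) (sym (toℕ-⊕ p i))))

  ⊕-identityʳ : ∀ (p : Fin n) → p ⊕ 0 ≡ p
  ⊕-identityʳ p = toℕ-injective
    (trans (toℕ-⊕ p 0) (trans (cong (_% n) (+-identityʳ (toℕ p))) (m<n⇒m%n≡m (toℕ<n p))))

  p+k+[n∸p]≡k+n : ∀ (p : Fin n) k → toℕ p + k + (n ∸ toℕ p) ≡ k + n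
  p+k+[n∸p]≡k+n p k = begin
    toℕ p + k + (n ∸ toℕ p)   ≡⟨ cong (_+ (n ∸ toℕ p)) (+-comm (toℕ p) k) ⟩
    k + toℕ p + (n ∸ toℕ p)   ≡⟨ +-assoc k (toℕ p) (n ∸ toℕ p) ⟩
    k + (toℕ p + (n ∸ toℕ p)) ≡⟨ cong (k +_) (m+[n∸m]≡n (<⇒≤ (toℕ<n p))) ⟩
    k + n                     ∎
    where open ≡-Reasoning

  offset<n : ∀ (p x : Fin n) → offset p x < n
  offset<n p x = m%n<n _ n

  offset-⊕ : ∀ (p : Fin n) i → offset p (p ⊕ i) ≡ i % n
  offset-⊕ p i = begin
    (toℕ (p ⊕ i) + (n ∸ toℕ p)) % n     ≡⟨ cong (λ t → (t + (n ∸ toℕ p)) % n) (toℕ-⊕ p i) ⟩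
    ((toℕ p + i) % n + (n ∸ toℕ p)) % n ≡⟨ [m%n+k]%n≡[m+k]%n (toℕ p + i) (n ∸ toℕ p) ⟩
    (toℕ p + i + (n ∸ toℕ p)) % n       ≡⟨ cong (_% n) (p+k+[n∸p]≡k+n p i) ⟩
    (i + n) % n                         ≡⟨ [m+n]%n≡m%n i n ⟩
    i % n                               ∎
    where open ≡-Reasoning

  ⊕-offset : ∀ (p x : Fin n) → p ⊕ offset p x ≡ x
  ⊕-offset p x = toℕ-injective (begin
    toℕ (p ⊕ offset p x)                    ≡⟨ toℕ-⊕ p (offset p x) ⟩
    (toℕ p + (toℕ x + (n ∸ toℕ p)) % n) % n ≡⟨ [m+k%n]%n≡[m+k]%n (toℕ p) (toℕ x + (n ∸ toℕ p)) ⟩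
    (toℕ p + (toℕ x + (n ∸ toℕ p))) % n     ≡⟨ cong (_% n) (+-assoc (toℕ p) (toℕ x) _) ⟨
    (toℕ p + toℕ x + (n ∸ toℕ p)) % n       ≡⟨ cong (_% n) (p+k+[n∸p]≡k+n p (toℕ x)) ⟩
    (toℕ x + n) % n                         ≡⟨ [m+n]%n≡m%n (toℕ x) n ⟩
    toℕ x % n                               ≡⟨ m<n⇒m%n≡m (toℕ<n x) ⟩
    toℕ x                                   ∎)
    where open ≡-Reasoning

  ⊕-cancelˡ : ∀ (p : Fin n) {u v} → u < n → p ⊕ u ≡ p ⊕ v → u ≡ v % n
  ⊕-cancelˡ p {u} {v} u<n eq = begin
    u                ≡⟨ m<n⇒m%n≡m u<n ⟨
    u % n            ≡⟨ offset-⊕ p u ⟨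
    offset p (p ⊕ u) ≡⟨ cong (offset p) eq ⟩
    offset p (p ⊕ v) ≡⟨ offset-⊕ p v ⟩
    v % n            ∎
    where open ≡-Reasoning

  _at_ : SubsetP n → Fin n → ℕ → Set
  (S at p) u = S (p ⊕ u)

  at-offset : ∀ (S : SubsetP n) p x → S x ⇔ (S at p) (offset p x)
  at-offset S p x = mk⇔ (subst S (sym (⊕-offset p x))) (subst S (⊕-offset p x))

  ∃%⇔Run : ∀ {s m u} → s ≤ n → m ≤ n → u < n → (∃ λ i → i < m × u ≡ (s + i) % n) ⇔ Run s m u
  ∃%⇔Run {s} {m} {u} s≤n m≤n u<n = mk⇔ toRun fromRun
    where
    toRun : (∃ λ i → i < m × u ≡ (s + i) % n) → Run s m u
    toRun (i , i<m , refl) with s + i <? n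
    ... | yes s+i<n rewrite m<n⇒m%n≡m s+i<n = inj₁ (m≤m+n s i , +-monoʳ-< s i<m)
    ... | no s+i≮n = inj₂ (subst (_< s + m) (sym (n≤m<n+n⇒m%n+n≡m n≤s+i s+i<2n)) (+-monoʳ-< s i<m))
      where
      n≤s+i = ≮⇒≥ s+i≮n
      s+i<2n = +-mono-≤-< s≤n (<-≤-trans i<m m≤n)
    fromRun : Run s m u → ∃ λ i → i < m × u ≡ (s + i) % n
    fromRun (inj₁ (s≤u , u<s+m)) = u ∸ s ,
      +-cancelˡ-< s _ _ (subst (_< s + m) (sym (m+[n∸m]≡n s≤u)) u<s+m) ,
      trans (sym (m<n⇒m%n≡m u<n)) (cong (_% n) (sym (m+[n∸m]≡n s≤u)))
    fromRun (inj₂ u+n<s+m) = u + n ∸ s ,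
      +-cancelˡ-< s _ _ (subst (_< s + m) (sym s+i≡u+n) u+n<s+m) ,
      trans (sym (m<n⇒m%n≡m u<n)) (trans (sym ([m+n]%n≡m%n u n)) (cong (_% n) (sym s+i≡u+n)))
      where
      s+i≡u+n : s + (u + n ∸ s) ≡ u + n
      s+i≡u+n = m+[n∸m]≡n (≤-trans s≤n (m≤n+m n u))

  arcSet-⊕ : ∀ (p : Fin n) s m {u} → u < n →
    arcSet (p ⊕ s) m (p ⊕ u) ⇔ (∃ λ i → i < m × u ≡ (s + i) % n)
  arcSet-⊕ p s m u<n = mk⇔
    (λ (i , i<m , eq) → i , i<m , ⊕-cancelˡ p u<n (trans eq (⊕-+ p s i)))
    (λ (i , i<m , eq) → i , i<m , trans (cong (p ⊕_) eq) (trans (⊕-% p (s + i)) (sym (⊕-+ p s i))))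

  arcSet-at : ∀ (p : Fin n) {s m} → s ≤ n → m ≤ n → arcSet (p ⊕ s) m at p ≐ Run s m
  arcSet-at p {s} {m} s≤n m≤n u<n = ⇔-trans (arcSet-⊕ p s m u<n) (∃%⇔Run s≤n m≤n u<n)

  arcSet-origin-at : ∀ (p : Fin n) {ℓ} → ℓ ≤ n → arcSet p ℓ at p ≐ (_< ℓ)
  arcSet-origin-at p {ℓ} ℓ≤n {u} u<n = ⇔-trans
    (subst (λ q → arcSet q ℓ (p ⊕ u) ⇔ Run 0 ℓ u) (⊕-identityʳ p) (arcSet-at p z≤n ℓ≤n u<n))
    (⇔-trans (Run-≐-Between ℓ≤n u<n) (mk⇔ (λ (_ , u<ℓ) → u<ℓ) (z≤n ,_)))

  IsArc⇒IntervalOrCo : ∀ {S} (p : Fin n) → IsArc S → IntervalOrCo (S at p)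
  IsArc⇒IntervalOrCo {S} p (q , m , (_ , m≤n) , S⇔arc) =
    IntervalOrCo-resp (≐-sym S≐Run) (Run-IntervalOrCo (<⇒≤ (offset<n p q)))
    where
    S≐Run : S at p ≐ Run (offset p q) m
    S≐Run {u} u<n = ⇔-trans (S⇔arc (p ⊕ u))
      (subst (λ q′ → arcSet q′ m (p ⊕ u) ⇔ Run (offset p q) m u) (⊕-offset p q)
        (arcSet-at p (<⇒≤ (offset<n p q)) m≤n u<n))

  IsArc-Run : ∀ {S} (p : Fin n) {s m} → s ≤ n → 1 ≤ m → m ≤ n → S at p ≐ Run s m → IsArc S
  IsArc-Run {S} p {s} {m} s≤n 1≤m m≤n S≐Run = p ⊕ s , m , (1≤m , m≤n) , λ x →
    ⇔-trans (at-offset S p x) (⇔-trans (S≐Run (offset<n p x))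
      (⇔-trans (⇔-sym (arcSet-at p s≤n m≤n (offset<n p x))) (⇔-sym (at-offset (arcSet (p ⊕ s) m) p x))))

  interval⇒IsArc : ∀ {S} (p : Fin n) {a b u} → b ≤ n → S at p ≐ Between a b → u < n → (S at p) u → IsArc S
  interval⇒IsArc p {a} {b} b≤n S≐I u<n Su = IsArc-Run p (≤-trans a≤u (<⇒≤ u<n)) (m<n⇒0<n∸m a<b)
    (≤-trans (m∸n≤m b a) b≤n)
    (≐-trans S≐I (≐-sym Run≐I))
    where
    a≤u = proj₁ (to (S≐I u<n) Su)
    a<b = ≤-<-trans a≤u (proj₂ (to (S≐I u<n) Su))
    a+[b∸a]≡b = m+[n∸m]≡n (<⇒≤ a<b)
    Run≐I : Run a (b ∸ a) ≐ Between a b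
    Run≐I = subst (λ e → Run a (b ∸ a) ≐ Between a e) a+[b∸a]≡b
      (Run-≐-Between (subst (_≤ n) (sym a+[b∸a]≡b) b≤n))

  cointerval⇒IsArc : ∀ {S} (p : Fin n) {a b u} → a ≤ b → b ≤ n → S at p ≐ U.∁ (Between a b) →
    u < n → (S at p) u → IsArc S
  cointerval⇒IsArc p {a} {b} {u} a≤b b≤n S≐C u<n Su =
    IsArc-Run p b≤n (m<n⇒0<n∸m b<n+a) m≤n (≐-trans S≐C (≐-sym Run≐C))
    where
    b<n+a : b < n + a
    b<n+a with a ≤? u
    ... | yes a≤u = <-≤-trans (≤-<-trans (≮⇒≥ λ u<b → to (S≐C u<n) Su (a≤u , u<b)) u<n) (m≤m+n n a)
    ... | no a≰u  = ≤-<-trans (≤-trans b≤n (m≤m+n n u)) (+-monoʳ-< n (≰⇒> a≰u))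
    m = n + a ∸ b
    b+m≡n+a : b + m ≡ n + a
    b+m≡n+a = m+[n∸m]≡n (<⇒≤ b<n+a)
    m≤n : m ≤ n
    m≤n = m≤n+o⇒m∸n≤o (n + a) b (subst (_≤ b + n) (+-comm a n) (+-monoˡ-≤ n a≤b))
    Run≐C : Run b m ≐ U.∁ (Between a b)
    Run≐C = subst (λ k → Run b m ≐ U.∁ (Between k b)) (trans (cong (_∸ n) b+m≡n+a) (m+n∸m≡n n a))
      (Run-≐-∁Between (subst (n ≤_) (sym b+m≡n+a) (m≤m+n n a)))

  IntervalOrCo⇒IsArc : ∀ {S} (p : Fin n) {x} → IntervalOrCo (S at p) → S x → IsArc S
  IntervalOrCo⇒IsArc {S} p {x} S-arc Sx = by-shape S-arc (offset<n p x) (to (at-offset S p x) Sx)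
    where
    by-shape : IntervalOrCo (S at p) → ∀ {u} → u < n → (S at p) u → IsArc S
    by-shape (interval b≤n S≐I) = interval⇒IsArc p b≤n S≐I
    by-shape (cointerval {a} {b} b≤n S≐C) with a ≤? b
    ... | yes a≤b = cointerval⇒IsArc p a≤b b≤n S≐C
    ... | no a≰b  = cointerval⇒IsArc p ≤-refl b≤n (≐-trans S≐C (λ _ → ¬-cong-⇔ both-empty))
      where
      both-empty : ∀ {v} → Between a b v ⇔ Between b b v
      both-empty = mk⇔ (λ (a≤v , v<b) → contradiction (<-≤-trans v<b (<⇒≤ (≰⇒> a≰b))) (≤⇒≯ a≤v))
                       (λ (b≤v , v<b) → contradiction v<b (≤⇒≯ b≤v))

  IsArc⇒inhabited : ∀ {S : SubsetP n} → IsArc S → ∃ S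
  IsArc⇒inhabited (q , _ , (1≤m , _) , S⇔arc) = q , from (S⇔arc q) (0 , 1≤m , sym (⊕-identityʳ q))

  ⊆-at : ∀ {A B : SubsetP n} {A′ B′} (p : Fin n) → A at p ≐ A′ → B at p ≐ B′ → (A ⊆ B) ⇔ (A′ ⊆ₙ B′)
  ⊆-at {A} {B} {A′} {B′} p A≐A′ B≐B′ = mk⇔ to-at from-at
    where
    to-at : A ⊆ B → A′ ⊆ₙ B′
    to-at A⊆B u<n A′u = to (B≐B′ u<n) (A⊆B _ (from (A≐A′ u<n) A′u))
    from-at : A′ ⊆ₙ B′ → A ⊆ B
    from-at A′⊆B′ x Ax = from (at-offset B p x)
      (from (B≐B′ u<n) (A′⊆B′ u<n (to (A≐A′ u<n) (to (at-offset A p x) Ax))))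
      where u<n = offset<n p x

  StrictlyOverlap-at : ∀ {A B : SubsetP n} {A′ B′} (p : Fin n) → A at p ≐ A′ → B at p ≐ B′ →
    StrictlyOverlap A B ⇔ StrictlyOverlapₙ A′ B′
  StrictlyOverlap-at p A≐A′ B≐B′ =
    ¬-cong-⇔ (⊆-at p A≐A′ B≐B′) ×-⇔ ¬-cong-⇔ (⊆-at p B≐B′ A≐A′) ×-⇔
    ¬-cong-⇔ (⊆-at p (≐-∁ A≐A′) B≐B′) ×-⇔ ¬-cong-⇔ (⊆-at p B≐B′ (≐-∁ A≐A′))

  reverseArc-offset : ∀ (p : Fin n) ℓ x → reverseArc p ℓ x ≡ p ⊕ reflect ℓ (offset p x)
  reverseArc-offset p ℓ x with offset p x <? ℓ
  ... | yes _ = refl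
  ... | no _  = sym (⊕-offset p x)

  module _ (p : Fin n) {ℓ : ℕ} (ℓ≤n : ℓ ≤ n) where

    open Reflection ℓ ℓ≤n

    reverseArc-⊕ : ∀ {u} → u < n → reverseArc p ℓ (p ⊕ u) ≡ p ⊕ reflect ℓ u
    reverseArc-⊕ {u} u<n = trans (reverseArc-offset p ℓ (p ⊕ u))
      (cong (λ v → p ⊕ reflect ℓ v) (trans (offset-⊕ p u) (m<n⇒m%n≡m u<n)))

    reverseArc-involutive : ∀ x → reverseArc p ℓ (reverseArc p ℓ x) ≡ x
    reverseArc-involutive x = begin
      reverseArc p ℓ (reverseArc p ℓ x)             ≡⟨ cong (reverseArc p ℓ) (reverseArc-offset p ℓ x) ⟩
      reverseArc p ℓ (p ⊕ reflect ℓ (offset p x))   ≡⟨ reverseArc-⊕ (reflect-<n (offset<n p x)) ⟩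
      p ⊕ reflect ℓ (reflect ℓ (offset p x))        ≡⟨ cong (p ⊕_) (reflect-involutive {ℓ} (offset p x)) ⟩
      p ⊕ offset p x                                ≡⟨ ⊕-offset p x ⟩
      x                                             ∎
      where open ≡-Reasoning

    image-reverseArc-at : ∀ {J : SubsetP n} → image (reverseArc p ℓ) J at p ≐ (J at p) ∘ reflect ℓ
    image-reverseArc-at {J} {u} u<n =
      subst (λ y → image (reverseArc p ℓ) J (p ⊕ u) ⇔ J y) (reverseArc-⊕ u<n)
        (image-involution reverseArc-involutive (p ⊕ u))

    IsArc-image⇔ : ∀ {J : SubsetP n} → IsArc J →
      IsArc (image (reverseArc p ℓ) J) ⇔ IntervalOrCo ((J at p) ∘ reflect ℓ)
    IsArc-image⇔ J-arc = mk⇔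
      (IntervalOrCo-resp image-reverseArc-at ∘ IsArc⇒IntervalOrCo p)
      (λ reflected → let x , Jx = IsArc⇒inhabited J-arc in
        IntervalOrCo⇒IsArc p (IntervalOrCo-resp (≐-sym image-reverseArc-at) reflected) (x , Jx , refl))

lemma5p7 : (n : ℕ) .{{_ : NonZero n}} (p : Fin n) (ℓ : ℕ) → ValidLen n ℓ →
    (J : SubsetP n) → IsArc J →
    StrictlyOverlap (arcSet p ℓ) J ⇔ (¬ IsArc (image (reverseArc p ℓ) J))
lemma5p7 n p ℓ (_ , ℓ≤n) J J-arc = begin
  StrictlyOverlap (arcSet p ℓ) J          ∼⟨ StrictlyOverlap-at p (arcSet-origin-at p ℓ≤n) (≐-refl {J at p}) ⟩
  StrictlyOverlapₙ (_< ℓ) (J at p)        ∼⟨ reflect-IntervalOrCo-iff (IsArc⇒IntervalOrCo p J-arc) ⟩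
  (¬ IntervalOrCo ((J at p) ∘ reflect ℓ)) ∼⟨ ¬-cong-⇔ (⇔-sym (IsArc-image⇔ p ℓ≤n J-arc)) ⟩
  (¬ IsArc (image (reverseArc p ℓ) J))    ∎
  where
  open EquationalReasoning {k = equivalence}
  open Coordinates n
  open Reflection ℓ ℓ≤n
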